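{- Let $p = p_1 p_2 \cdots p_n$ be a permutation of $[n]=\{1,\dots,n\}$ that avoids the pattern $132$. Then for every $i \in [n]$, among all increasing subsequences of $p$ whose first entry is $p_i$, there is exactly one of maximal length.
   Context: A permutation $p=p_1\cdots p_n$ avoids $132$ if there are no indices $a<b<c$ with $p_a<p_c<p_b$. An increasing subsequence of $p$ is a sequence of entries $p_{j_1}<p_{j_2}<\cdots<p_{j_k}$ with $j_1<j_2<\cdots<j_k$; it begins (starts) at $p_{j_1}$. Maximality here is only among increasing subsequences starting at $p_i$, not among all increasing subsequences of $p$. -}

module Defs where

open import Data.Nat using (ℕ)
open import Data.Fin using (Fin) renaming (_<_ to _<ᶠ_)
open import Data.List using (List; []; _∷_)
open import Data.Product using (_×_)
open import Function.Bundles using (_↔_)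
open import Relation.Nullary using (¬_)
open import Data.Empty using (⊥)
open import Relation.Binary.PropositionalEquality using (_≡_)

-- A permutation of [n] (values encoded as Fin n = {0,…,n-1}, order-isomorphic
-- to {1,…,n}); position j ↦ value p_j.
Perm : ℕ → Set
Perm n = Fin n ↔ Fin n

Avoids132 : ∀ {n} → (Fin n → Fin n) → Set
Avoids132 {n} p =
  ∀ (a b c : Fin n) → a <ᶠ b → b <ᶠ c → ¬ (p a <ᶠ p c × p c <ᶠ p b)

data IncChain {n} (p : Fin n → Fin n) : Fin n → List (Fin n) → Set where
  last : ∀ {j} → IncChain p j []
  step : ∀ {j k ks} → j <ᶠ k → p j <ᶠ p k → IncChain p k ks →
         IncChain p j (k ∷ ks)

-- An increasing subsequence of p starting at p_i, given by its list of
-- positions (i ∷ rest). A subsequence is determined by its positions.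
IncSubseqFrom : ∀ {n} → (Fin n → Fin n) → Fin n → List (Fin n) → Set
IncSubseqFrom p i []       = ⊥
IncSubseqFrom p i (j ∷ js) = (j ≡ i) × IncChain p j js

{-# OPTIONS --safe #-}
module Submission where

-- Uniqueness comes from
-- 132-avoidance: a longest chain from j must step to the leftmost position k > j
-- with p k > p j, since if it stepped to a later k' then either p k < p k' and
-- inserting k would lengthen it, or p j < p k' < p k and j, k, k' would form a 132.
-- Hence two longest chains agree step by step.

open import Defs
open import Data.Nat using (ℕ; _≤_; suc; z≤n; s≤s; s≤s⁻¹)
open import Data.Nat.Properties using (≤-trans; ≤-reflexive; ≤-total; suc-injective; n≮n)
open import Data.Fin using (Fin; _<?_) renaming (_<_ to _<ᶠ_)
open import Data.Fin.Properties using (<-cmp; <-irrefl)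
open import Data.Fin.Induction using (>-wellFounded)
open import Data.List using (List; length; []; _∷_; allFin)
open import Data.List.Membership.Propositional using (_∈_)
open import Data.List.Membership.Propositional.Properties using (∈-allFin)
open import Data.List.Relation.Unary.Any using (here; there)
open import Data.Product using (Σ; _×_; _,_)
open import Data.Sum using (inj₁; inj₂)
open import Function.Bundles using (Inverse; Injection)
open import Function.Definitions using (Injective)
open import Function.Properties.Inverse using (↔⇒↣)
open import Induction.WellFounded using (module All)
open import Relation.Binary using (tri<; tri≈; tri>)
open import Relation.Binary.PropositionalEquality using (_≡_; refl; sym; cong)
open import Relation.Nullary using (¬_; yes; no; contradiction)
open import Relation.Nullary.Decidable using (_×-dec_)

module _ {n : ℕ} (p : Fin n → Fin n) where

  Extends : Fin n → Fin n → Set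
  Extends j k = j <ᶠ k × p j <ᶠ p k

  LongestFrom : Fin n → List (Fin n) → Set
  LongestFrom j cs = IncChain p j cs × (∀ ds → IncChain p j ds → length ds ≤ length cs)

  longestFrom-tail : ∀ {j k cs} → LongestFrom j (k ∷ cs) → LongestFrom k cs
  longestFrom-tail (step j<k pj<pk chain , maximal) =
    chain , λ ds ds-chain → s≤s⁻¹ (maximal (_ ∷ ds) (step j<k pj<pk ds-chain))

  longestFrom-of-length : ∀ {j cs ds} → LongestFrom j cs → IncChain p j ds →
                          length ds ≡ length cs → LongestFrom j ds
  longestFrom-of-length (_ , maximal) chain eq =
    chain , λ es es-chain → ≤-trans (maximal es es-chain) (≤-reflexive (sym eq))

  longestVia : ∀ j → (∀ k → Extends j k → Σ (List (Fin n)) (LongestFrom k)) → ∀ xs →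
               Σ (List (Fin n)) λ cs → IncChain p j cs ×
                 (∀ k ds → k ∈ xs → IncChain p j (k ∷ ds) → suc (length ds) ≤ length cs)
  longestVia j longest [] = [] , last , λ _ _ ()
  longestVia j longest (x ∷ xs) with longestVia j longest xs | (j <? x) ×-dec (p j <? p x)
  ... | cs , chain , best | no ¬ext =
    cs , chain , λ where
      k ds (here refl) (step j<x pj<px _) → contradiction (j<x , pj<px) ¬ext
      k ds (there k∈xs) ds-chain          → best k ds k∈xs ds-chain
  ... | cs , chain , best | yes ext@(j<x , pj<px) with longest x ext
  ...   | ms , ms-chain , ms-max with ≤-total (suc (length ms)) (length cs)
  ...     | inj₁ ms≤cs =
    cs , chain , λ where
      k ds (here refl) (step _ _ ds-chain) → ≤-trans (s≤s (ms-max ds ds-chain)) ms≤cs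
      k ds (there k∈xs) ds-chain           → best k ds k∈xs ds-chain
  ...     | inj₂ cs≤ms =
    x ∷ ms , step j<x pj<px ms-chain , λ where
      k ds (here refl) (step _ _ ds-chain) → s≤s (ms-max ds ds-chain)
      k ds (there k∈xs) ds-chain           → ≤-trans (best k ds k∈xs ds-chain) cs≤ms

  longestFrom : ∀ j → Σ (List (Fin n)) (LongestFrom j)
  longestFrom = All.wfRec >-wellFounded _ _ λ j longest →
    let cs , chain , best = longestVia j (λ k (j<k , _) → longest j<k) (allFin n)
    in cs , chain , λ where
         []       _        → z≤n
         (k ∷ ds) ds-chain → best k ds (∈-allFin k) ds-chain

  module _ (injective : Injective _≡_ _≡_ p) (avoids : Avoids132 p) where

    longestFrom-steps-leftmost : ∀ {j k k' cs} → Extends j k → LongestFrom j (k' ∷ cs) →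
                                 ¬ k <ᶠ k'
    longestFrom-steps-leftmost {k = k} {k'} (j<k , pj<pk) (step _ pj<pk' chain , maximal) k<k'
      with <-cmp (p k) (p k')
    ... | tri< pk<pk' _ _ = n≮n _
                              (maximal (k ∷ k' ∷ _) (step j<k pj<pk (step k<k' pk<pk' chain)))
    ... | tri≈ _ pk≡pk' _ = <-irrefl (injective pk≡pk') k<k'
    ... | tri> _ _ pk'<pk = avoids _ k k' j<k k<k' (pj<pk' , pk'<pk)

    longestFrom-unique : ∀ {j cs ds} → LongestFrom j cs → LongestFrom j ds → cs ≡ ds
    longestFrom-unique {cs = []} {[]} _ _ = refl
    longestFrom-unique {cs = []} {_ ∷ _} (_ , maximal) (chain , _) with maximal _ chain
    ... | ()
    longestFrom-unique {cs = _ ∷ _} {[]} (chain , _) (_ , maximal) with maximal _ chain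
    ... | ()
    longestFrom-unique {cs = k ∷ _} {k' ∷ _} cs-longest@(step j<k pj<pk _ , _)
                                               ds-longest@(step j<k' pj<pk' _ , _)
      with <-cmp k k'
    ... | tri< k<k' _ _ = contradiction k<k' (longestFrom-steps-leftmost (j<k , pj<pk) ds-longest)
    ... | tri> _ _ k'<k = contradiction k'<k (longestFrom-steps-leftmost (j<k' , pj<pk') cs-longest)
    ... | tri≈ _ refl _ =
      cong (k ∷_) (longestFrom-unique (longestFrom-tail cs-longest) (longestFrom-tail ds-longest))

lemma1 : (n : ℕ) (p : Perm n) → Avoids132 (Inverse.to p) → (i : Fin n) →
    Σ (List (Fin n)) λ js →
    IncSubseqFrom (Inverse.to p) i js
    × (∀ ks → IncSubseqFrom (Inverse.to p) i ks → length ks ≤ length js)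
    × (∀ ks → IncSubseqFrom (Inverse.to p) i ks → length ks ≡ length js → ks ≡ js)
lemma1 n P avoids i with longestFrom (Inverse.to P) i
... | cs , cs-longest@(chain , maximal) = i ∷ cs , (refl , chain) , longest , unique
  where
  p : Fin n → Fin n
  p = Inverse.to P
  longest : ∀ ks → IncSubseqFrom p i ks → length ks ≤ length (i ∷ cs)
  longest (_ ∷ ks) (refl , ks-chain) = s≤s (maximal ks ks-chain)
  unique : ∀ ks → IncSubseqFrom p i ks → length ks ≡ length (i ∷ cs) → ks ≡ i ∷ cs
  unique (_ ∷ ks) (refl , ks-chain) eq = cong (i ∷_) (longestFrom-unique p
    (Injection.injective (↔⇒↣ P)) avoids
    (longestFrom-of-length p cs-longest ks-chain (suc-injective eq)) cs-longest)
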